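{- Let $n\in\mathbb{Z}^+$, let $S$ be a sequence of positive integers, and let $\alpha\in\mathrm{UPF}^{\mathrm{T3}}_{n,S}$. If $\sigma$ is a rearrangement of the entries of $\alpha$ that is a unit interval parking function, then $\sigma\in\mathrm{UPF}^{\mathrm{T3}}_{n,S}$.
   Context: A parking preference $(a_1,\dots,a_n)\in[n]^n$ describes $n$ cars entering a one-way street with spots $1,\dots,n$ in the order $1,\dots,n$; car $i$ parks in the first unoccupied spot numbered $\ge a_i$. It is a parking function if all cars park. It is a unit interval parking function if it is a parking function and every car $i$ parks in spot $a_i$ or $a_i+1$. Block structure: let $\alpha^{\uparrow}=(a_1',\dots,a_n')$ be the weakly increasing rearrangement of $\alpha$. The indices $i$ with $a'_i=i$ are block starts; the block structure $\pi_1|\cdots|\pi_k$ cuts $\alpha^{\uparrow}$ into consecutive segments, each beginning at a block start, listed left to right. For $S=(s_1,s_2,\dots)$, $\mathrm{UPF}^{\mathrm{T3}}_{n,S}$ is the set of unit interval parking functions of length $n$ with $|\pi_i|\le s_i$ for every block $\pi_i$. -}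

module Defs where

open import Data.Nat using (ℕ; zero; suc; _≤_; _<_; _≟_; _<ᵇ_)
open import Data.Nat.Properties using (≤-decTotalOrder)
open import Data.Bool using (Bool; true; false; if_then_else_)
open import Data.List using (List; []; _∷_; length; reverse)
open import Data.List.Relation.Unary.All using (All)
open import Data.List.Relation.Binary.Pointwise using (Pointwise)
open import Data.List.Membership.DecPropositional _≟_ using (_∈?_)
open import Data.Maybe using (Maybe; just; nothing)
open import Data.Product using (_×_; ∃-syntax)
open import Data.Sum using (_⊎_)
open import Data.Unit using (⊤)
open import Relation.Binary.PropositionalEquality using (_≡_)
open import Relation.Nullary using (does)
import Data.List.Sort.InsertionSort as InsSort

IsPreference : ℕ → List ℕ → Set
IsPreference n α = length α ≡ n × All (λ a → 1 ≤ a × a ≤ n) α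

-- First unoccupied spot s with a ≤ s ≤ n (given the list `occ` of
-- occupied spots); `fuel` bounds the search.
firstFree : ℕ → ℕ → ℕ → List ℕ → Maybe ℕ
firstFree n zero     s occ = nothing
firstFree n (suc k)  s occ =
  if n <ᵇ s then nothing
  else (if does (s ∈? occ) then firstFree n k (suc s) occ else just s)

parkFrom : ℕ → List ℕ → List ℕ → Maybe (List ℕ)
parkFrom n occ [] = just []
parkFrom n occ (a ∷ as) with firstFree n (suc n) a occ
... | nothing = nothing
... | just s with parkFrom n (s ∷ occ) as
...   | nothing = nothing
...   | just ss = just (s ∷ ss)

parkingOutcome : ℕ → List ℕ → Maybe (List ℕ)
parkingOutcome n α = parkFrom n [] α

IsParkingFunction : ℕ → List ℕ → Set
IsParkingFunction n α =
  IsPreference n α × ∃[ ps ] parkingOutcome n α ≡ just ps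

IsUnitIntervalPF : ℕ → List ℕ → Set
IsUnitIntervalPF n α =
  IsPreference n α ×
  ∃[ ps ] (parkingOutcome n α ≡ just ps ×
           Pointwise (λ a p → p ≡ a ⊎ p ≡ suc a) α ps)

sortInc : List ℕ → List ℕ
sortInc = InsSort.sort ≤-decTotalOrder

-- Cut a weakly increasing list (a'_i, a'_{i+1}, …) into consecutive
-- segments, a new segment beginning at each index j with a'_j = j.
-- `i` is the (1-based) index of the head, `cur` the current segment
-- (reversed).
cutBlocks : ℕ → List ℕ → List ℕ → List (List ℕ)
cutBlocks i []       []  = []
cutBlocks i []       cur = reverse cur ∷ []
cutBlocks i (x ∷ xs) cur with does (x ≟ i) | cur
... | true  | []      = cutBlocks (suc i) xs (x ∷ [])
... | true  | c ∷ cs  = reverse (c ∷ cs) ∷ cutBlocks (suc i) xs (x ∷ [])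
... | false | cs      = cutBlocks (suc i) xs (x ∷ cs)

blockStructure : List ℕ → List (List ℕ)
blockStructure α = cutBlocks 1 (sortInc α) []

-- |π_i| ≤ s_i for every block, where S is indexed from 0:
-- s_1 = S 0, s_2 = S 1, …
BlocksBoundedFrom : (ℕ → ℕ) → ℕ → List (List ℕ) → Set
BlocksBoundedFrom S i []       = ⊤
BlocksBoundedFrom S i (b ∷ bs) = length b ≤ S i × BlocksBoundedFrom S (suc i) bs

BlocksBounded : (ℕ → ℕ) → List (List ℕ) → Set
BlocksBounded S bs = BlocksBoundedFrom S 0 bs

IsUPF-T3 : ℕ → (ℕ → ℕ) → List ℕ → Set
IsUPF-T3 n S α = IsUnitIntervalPF n α × BlocksBounded S (blockStructure α)

-- The block structure of α is read off its weakly increasing rearrangement α↑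
-- alone, and a sorted list is determined by the multiset of its entries. So a
-- rearrangement σ of α has the same blocks as α, and the bounds |πᵢ| ≤ sᵢ carry
-- over; the unit-interval condition on σ is a hypothesis.
module Submission where

open import Defs
open import Data.Nat using (ℕ; _<_)
open import Data.Nat.Properties using (≤-totalOrder; ≤-decTotalOrder)
open import Data.List using (List; [])
open import Data.List.Relation.Binary.Permutation.Propositional
  using (_↭_; ↭-sym; ↭-trans; ↭⇒↭ₛ)
open import Data.List.Relation.Binary.Pointwise using (Pointwise-≡⇒≡)
open import Data.List.Relation.Unary.Sorted.TotalOrder ≤-totalOrder using (Sorted)
open import Data.List.Relation.Unary.Sorted.TotalOrder.Properties using (↗↭↗⇒≋)
open import Data.List.Sort.InsertionSort.Properties ≤-decTotalOrder using (sort-↭; sort-↗)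
open import Data.Product using (_,_)
open import Relation.Binary.PropositionalEquality using (_≡_; cong; subst; sym)

sorted-↭⇒≡ : ∀ {xs ys : List ℕ} → Sorted xs → Sorted ys → xs ↭ ys → xs ≡ ys
sorted-↭⇒≡ xs↗ ys↗ xs↭ys = Pointwise-≡⇒≡ (↗↭↗⇒≋ ≤-totalOrder xs↗ ys↗ (↭⇒↭ₛ xs↭ys))

sortInc-cong-↭ : ∀ {xs ys : List ℕ} → xs ↭ ys → sortInc xs ≡ sortInc ys
sortInc-cong-↭ {xs} {ys} xs↭ys =
  sorted-↭⇒≡ (sort-↗ xs) (sort-↗ ys)
    (↭-trans (sort-↭ xs) (↭-trans xs↭ys (↭-sym (sort-↭ ys))))

blockStructure-cong-↭ : ∀ {xs ys : List ℕ} → xs ↭ ys → blockStructure xs ≡ blockStructure ys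
blockStructure-cong-↭ xs↭ys = cong (λ l → cutBlocks 1 l []) (sortInc-cong-↭ xs↭ys)

proposition5p11 : (n : ℕ) → 0 < n → (S : ℕ → ℕ) → (∀ i → 0 < S i) →
                  (α σ : List ℕ) → IsUPF-T3 n S α →
                  σ ↭ α → IsUnitIntervalPF n σ → IsUPF-T3 n S σ
proposition5p11 n _ S _ α σ (_ , α-bounded) σ↭α σ-unit =
  σ-unit , subst (BlocksBounded S) (sym (blockStructure-cong-↭ σ↭α)) α-bounded
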